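{- For a positive integer $n$, let $\pi_n$ be a uniformly random permutation in $S_n$, let $c(\pi_n)$ be its number of cycles and $\mathrm{ord}(\pi_n)$ its order. Then for any $\ell, m, n \in \mathbb{N}$, \[\mathbb{P}\bigl(c(\pi_n) = \ell,\ \mathrm{ord}(\pi_n) \mid m\bigr) \leq \frac{1}{n(\ell-1)!}\Bigl(\frac{\sigma(m)}{m}\Bigr)^{\ell-1},\] where $\sigma(m)$ denotes the sum of the positive divisors of $m$. -}

module Defs where

open import Data.Nat using (ℕ; zero; suc; _≤_; _<_; _+_)
open import Data.Nat.Divisibility using (_∣_; _∣?_)
open import Data.Fin using (Fin)
open import Data.Fin.Permutation using (Permutation′; _⟨$⟩ʳ_; _≈_; id)
open import Data.List using (List; filter; applyUpTo)
open import Data.Nat.ListAction using (sum)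
open import Data.Product using (Σ; ∃; _×_)
open import Relation.Nullary using (¬_)
open import Relation.Binary.PropositionalEquality using (_≡_)

iter : ∀ {n} → Permutation′ n → ℕ → Fin n → Fin n
iter π zero    x = x
iter π (suc k) x = π ⟨$⟩ʳ iter π k x

PowIsId : ∀ {n} → Permutation′ n → ℕ → Set
PowIsId π k = ∀ x → iter π k x ≡ x

IsOrder : ∀ {n} → Permutation′ n → ℕ → Set
IsOrder π k = 1 ≤ k × PowIsId π k × (∀ j → 1 ≤ j → j < k → ¬ PowIsId π j)

OrderDivides : ∀ {n} → Permutation′ n → ℕ → Set
OrderDivides π m = Σ ℕ λ k → IsOrder π k × k ∣ m

SameCycle : ∀ {n} → Permutation′ n → Fin n → Fin n → Set
SameCycle π x y = ∃ λ k → iter π k x ≡ y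

-- c(π) = ℓ : the cycles (orbits of ⟨π⟩) are in bijection with Fin ℓ,
-- witnessed by a system of representatives r (one point per cycle).
HasCycleCount : ∀ {n} → Permutation′ n → ℕ → Set
HasCycleCount {n} π ℓ =
  Σ (Fin ℓ → Fin n) λ r →
    (∀ x → ∃ λ i → SameCycle π (r i) x) ×
    (∀ i j → SameCycle π (r i) (r j) → i ≡ j)

Event : ∀ {n} → ℕ → ℕ → Permutation′ n → Set
Event ℓ m π = HasCycleCount π ℓ × OrderDivides π m

Distinct : ∀ {n} → Permutation′ n → Permutation′ n → Set
Distinct π ρ = ¬ (π ≈ ρ)

σ : ℕ → ℕ
σ m = sum (filter (_∣? m) (applyUpTo suc m))

{-# OPTIONS --safe #-}
-- Proof by an injection.  Let π have ℓ = k + 1 cycles and π^M = id.  Besides π, choose a point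
-- x, an ordering o of the k cycles not containing x, and u ∈ {0, …, M - 1}^k: n · k! · M^k
-- choices.  If the i-th cycle in o has length d (so d ∣ M), write u_i = s + q d with s < d; list
-- that cycle starting from π^s of its representative, concatenate these lists in the order o,
-- and append the cycle of x starting at x.  This is an arrangement of the n points (n! of them),
-- and alongside it we record the labels (M / d, q): pairs (e, q) with e ∣ M and q < e, of which
-- there are σ(M).  The labels give the block lengths, so the arrangement can be cut back into
-- the cycles of π, which determine π; once π is known, x, o and u are read off as well.  So the
-- distinct permutations of the event get n · k! · M^k distinct codes each, among n! · σ(M)^k.

module Submission where

open import Defs
open import Data.Nat using (ℕ; zero; suc; _+_; _*_; _^_; _∸_; _!; _≤_; _<_; _%_; _/_; NonZero; >-nonZero; s≤s; z≤n)
open import Data.Nat.Properties using (+-comm; *-comm; +-suc; suc-injective; ≤-antisym; ≤-trans; ≤-pred; <-cmp; m≤n+m; m≤n⇒∃[o]m+o≡n; m≤n⇒m<n∨m≡n; *-cancelʳ-≡; module ≤-Reasoning)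
open import Data.Nat.DivMod using (m≡m%n+[m/n]*n; m%n<n; m/n*n≡m; m*[n/m]≡n; m≥n⇒m/n>0; m<n*o⇒m/o<n)
open import Data.Nat.Divisibility using (_∣_; _∣?_; divides; ∣⇒≤; m/n∣m; m%n≡0⇒n∣m)
open import Data.Nat.ListAction using (sum)
open import Data.Fin using (Fin; zero; suc; toℕ; punchIn; punchOut; _≟_)
open import Data.Fin.Properties using (injective⇒≤; toℕ<n; toℕ-injective; punchIn-injective; punchInᵢ≢i; punchIn-punchOut)
open import Data.Fin.Permutation using (Permutation′; _⟨$⟩ʳ_; _⟨$⟩ˡ_; inverseˡ; _≈_)
open import Data.List using (List; []; _∷_; [_]; _++_; map; concat; concatMap; length; lookup; zip; filter; applyUpTo; upTo; allFin; cartesianProduct; cartesianProductWith)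
open import Data.List.Properties using (length-++; length-map; length-applyUpTo; length-upTo; length-tabulate; ∷-injective; ∷-injectiveˡ; ∷-injectiveʳ; ++-assoc; map-injective; map-cong; map-id; map-∘)
open import Data.List.Relation.Unary.All as All using (All; []; _∷_)
import Data.List.Relation.Unary.All.Properties as All
open import Data.List.Relation.Unary.AllPairs as AllPairs using (AllPairs; []; _∷_)
import Data.List.Relation.Unary.AllPairs.Properties as AllPairs
open import Data.List.Relation.Unary.Any as Any using (here; there; index)
open import Data.List.Relation.Unary.Any.Properties using (lookup-index)
open import Data.List.Relation.Unary.Unique.Propositional using (Unique)
import Data.List.Relation.Unary.Unique.Propositional.Properties as Unique
open import Data.List.Relation.Binary.Disjoint.Propositional using (Disjoint)
import Data.List.Relation.Binary.Pointwise as Pointwise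
open import Data.List.Membership.Propositional using (_∈_)
open import Data.List.Membership.Propositional.Properties using (∈-lookup; ∈-map⁺; ∈-map⁻; ∈-allFin; ∈-upTo⁺; ∈-applyUpTo⁺; ∈-applyUpTo⁻; ∈-filter⁺; ∈-++⁺ˡ; ∈-++⁺ʳ; ∈-++⁻; ∈-concat⁺′; ∈-concat⁻′; ∈-concatMap⁺; ∈-concatMap⁻; ∈-cartesianProductWith⁺; ∈-cartesianProductWith⁻; ∈-cartesianProduct⁺; ∈-cartesianProduct⁻)
open import Data.Product using (Σ; ∃; ∃₂; _×_; _,_; proj₁; proj₂)
open import Data.Sum using (inj₁; inj₂)
open import Function using (_∘_)
open import Relation.Binary using (tri<; tri≈; tri>)
open import Relation.Binary.PropositionalEquality using (_≡_; _≢_; refl; sym; trans; cong; cong₂; subst; setoid; module ≡-Reasoning)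
open import Relation.Nullary using (¬_; Dec; yes; no; contradiction)
open import Relation.Unary using (Decidable)

private variable
  A B C : Set
  n : ℕ
  xs ys : List A

-- Counting with duplicate-free lists

length-concatMap : (f : A → List B) (xs : List A) → length (concatMap f xs) ≡ sum (map (length ∘ f) xs)
length-concatMap f []       = refl
length-concatMap f (x ∷ xs) = trans (length-++ (f x)) (cong (length (f x) +_) (length-concatMap f xs))

length-cartesianProductWith : (f : A → B → C) (xs : List A) (ys : List B) →
  length (cartesianProductWith f xs ys) ≡ length xs * length ys
length-cartesianProductWith f []       ys = refl
length-cartesianProductWith f (x ∷ xs) ys = begin
  length (map (f x) ys ++ cartesianProductWith f xs ys) ≡⟨ length-++ (map (f x) ys) ⟩
  length (map (f x) ys) + length (cartesianProductWith f xs ys)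
    ≡⟨ cong₂ _+_ (length-map (f x) ys) (length-cartesianProductWith f xs ys) ⟩
  length ys + length xs * length ys ∎
  where open ≡-Reasoning

Unique-lookup-injective : Unique xs → ∀ i j → lookup xs i ≡ lookup xs j → i ≡ j
Unique-lookup-injective (_  ∷ _) zero    zero    _ = refl
Unique-lookup-injective (x∉ ∷ _) zero    (suc j) e = contradiction e (All.lookup x∉ (∈-lookup j))
Unique-lookup-injective (x∉ ∷ _) (suc i) zero    e = contradiction (sym e) (All.lookup x∉ (∈-lookup i))
Unique-lookup-injective (_  ∷ u) (suc i) (suc j) e = cong suc (Unique-lookup-injective u i j e)

Unique⇒length≤ : {zs ys : List A} → Unique zs → All (_∈ ys) zs → length zs ≤ length ys
Unique⇒length≤ {zs = zs} {ys} u zs⊆ys = injective⇒≤ {f = position} position-injective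
  where
  position : Fin (length zs) → Fin (length ys)
  position i = index (All.lookup zs⊆ys (∈-lookup i))
  position-injective : ∀ {i j} → position i ≡ position j → i ≡ j
  position-injective {i} {j} e = Unique-lookup-injective u i j (begin
    lookup zs i                   ≡⟨ lookup-index (All.lookup zs⊆ys (∈-lookup i)) ⟩
    lookup ys (position i)        ≡⟨ cong (lookup ys) e ⟩
    lookup ys (position j)        ≡⟨ lookup-index (All.lookup zs⊆ys (∈-lookup j)) ⟨
    lookup zs j                   ∎)
    where open ≡-Reasoning

Unique-map⁺-injectiveOn : {P : A → Set} {f : A → B} → (∀ {a b} → P a → P b → f a ≡ f b → a ≡ b) →
  All P xs → Unique xs → Unique (map f xs)
Unique-map⁺-injectiveOn inj []         []         = []
Unique-map⁺-injectiveOn inj (pa ∷ pxs) (a∉ ∷ u) =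
  All.map⁺ (All.zipWith (λ (pb , a≢b) fa≡fb → a≢b (inj pa pb fa≡fb)) (pxs , a∉))
  ∷ Unique-map⁺-injectiveOn inj pxs u

Unique-cartesianProductWith⁺ : {R : A → A → Set} (f : A → B → C) →
  (∀ a → Unique (map (f a) ys)) → (∀ {a a'} → R a a' → Disjoint (map (f a) ys) (map (f a') ys)) →
  AllPairs R xs → Unique (cartesianProductWith f xs ys)
Unique-cartesianProductWith⁺ f u disjoint []                     = []
Unique-cartesianProductWith⁺ {ys = ys} {xs = x ∷ xs} f u disjoint (Rx ∷ Rxs) =
  Unique.++⁺ (u x) (Unique-cartesianProductWith⁺ f u disjoint Rxs) λ (v∈fx , v∈rest) →
    let a , b , a∈xs , b∈ys , v≡fab = ∈-cartesianProductWith⁻ f xs ys v∈rest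
    in disjoint (All.lookup Rx a∈xs) (v∈fx , subst (_∈ map (f a) ys) (sym v≡fab) (∈-map⁺ (f a) b∈ys))

++-injective : ∀ (xs xs' : List A) {ys ys'} → length xs ≡ length xs' →
  xs ++ ys ≡ xs' ++ ys' → xs ≡ xs' × ys ≡ ys'
++-injective []       []         _ e = refl , e
++-injective (x ∷ xs) (x' ∷ xs') l e with refl , e′ ← ∷-injective e =
  let xs≡xs' , ys≡ys' = ++-injective xs xs' (suc-injective l) e′ in cong (x ∷_) xs≡xs' , ys≡ys'

concat-++-injective : ∀ (xss xss' : List (List A)) {ys ys'} → map length xss ≡ map length xss' →
  concat xss ++ ys ≡ concat xss' ++ ys' → xss ≡ xss' × ys ≡ ys'
concat-++-injective []         []           _  e = refl , e
concat-++-injective (xs ∷ xss) (xs' ∷ xss') {ys} {ys'} ls e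
  with refl , e′ ← ++-injective xs xs' (∷-injectiveˡ ls)
                     (trans (sym (++-assoc xs (concat xss) ys)) (trans e (++-assoc xs' (concat xss') ys'))) =
  let xss≡xss' , ys≡ys' = concat-++-injective xss xss' (∷-injectiveʳ ls) e′
  in cong (xs ∷_) xss≡xss' , ys≡ys'

map-injective₂ : {f : A → B} {g : A → C} → (∀ {a b} → f a ≡ f b → g a ≡ g b → a ≡ b) →
  map f xs ≡ map f ys → map g xs ≡ map g ys → xs ≡ ys
map-injective₂ {xs = []}    {[]}    inj _ _ = refl
map-injective₂ {xs = x ∷ xs} {y ∷ ys} inj e e′ =
  cong₂ _∷_ (inj (∷-injectiveˡ e) (∷-injectiveˡ e′))
            (map-injective₂ inj (∷-injectiveʳ e) (∷-injectiveʳ e′))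

map-proj₁-zip : ∀ (xs : List A) (ys : List B) → length xs ≡ length ys → map proj₁ (zip xs ys) ≡ xs
map-proj₁-zip []       []       _ = refl
map-proj₁-zip (x ∷ xs) (y ∷ ys) l = cong (x ∷_) (map-proj₁-zip xs ys (suc-injective l))

map-proj₂-zip : ∀ (xs : List A) (ys : List B) → length xs ≡ length ys → map proj₂ (zip xs ys) ≡ ys
map-proj₂-zip []       []       _ = refl
map-proj₂-zip (x ∷ xs) (y ∷ ys) l = cong (y ∷_) (map-proj₂-zip xs ys (suc-injective l))

map-proj₁-toList : {P : A → Set} (pxs : All P xs) → map proj₁ (All.toList pxs) ≡ xs
map-proj₁-toList []         = refl
map-proj₁-toList (px ∷ pxs) = cong (_ ∷_) (map-proj₁-toList pxs)

map-≡⇒map-≡ : ∀ {D : Set} {f : A → C} {g : B → C} {F : A → D} {G : B → D} {xs ys} →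
  (∀ {a b} → f a ≡ g b → F a ≡ G b) → map f xs ≡ map g ys → map F xs ≡ map G ys
map-≡⇒map-≡ {f = f} {g} {F} {G} transfer e =
  Pointwise.Pointwise-≡⇒≡
    (Pointwise.map⁺ F G (Pointwise.map transfer (Pointwise.map⁻ f g (Pointwise.≡⇒Pointwise-≡ e))))

-- Arrangements and words

IsArrangement : List (Fin n) → Set
IsArrangement xs = Unique xs × (∀ y → y ∈ xs)

length-allFin : ∀ n → length (allFin n) ≡ n
length-allFin n = length-tabulate {n = n} (λ i → i)

arrangement-length : {xs : List (Fin n)} → IsArrangement xs → length xs ≡ n
arrangement-length {n} {xs} (unique , complete) = ≤-antisym
  (subst (length xs ≤_) (length-allFin n) (Unique⇒length≤ unique (All.universal ∈-allFin xs)))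
  (subst (_≤ length xs) (length-allFin n)
    (Unique⇒length≤ (Unique.allFin⁺ n) (All.universal complete (allFin n))))

cons-punchIn : Fin (suc n) → List (Fin n) → List (Fin (suc n))
cons-punchIn x ys = x ∷ map (punchIn x) ys

arrangements : ∀ n → List (List (Fin n))
arrangements zero    = [ [] ]
arrangements (suc n) = cartesianProductWith cons-punchIn (allFin (suc n)) (arrangements n)

length-arrangements : ∀ n → length (arrangements n) ≡ n !
length-arrangements zero    = refl
length-arrangements (suc n) =
  trans (length-cartesianProductWith cons-punchIn (allFin (suc n)) (arrangements n))
        (cong₂ _*_ (length-allFin (suc n)) (length-arrangements n))

arrangements-unique : ∀ n → Unique (arrangements n)
arrangements-unique zero    = [] ∷ []
arrangements-unique (suc n) =
  Unique.cartesianProductWith⁺ cons-punchIn cons-punchIn-injective (Unique.allFin⁺ (suc n)) (arrangements-unique n)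
  where
  cons-punchIn-injective : ∀ {x x' ys ys'} → cons-punchIn x ys ≡ cons-punchIn x' ys' → x ≡ x' × ys ≡ ys'
  cons-punchIn-injective {x} e with refl , e′ ← ∷-injective e =
    refl , map-injective (punchIn-injective x _ _) e′

cons-punchIn-isArrangement : ∀ x {ys : List (Fin n)} → IsArrangement ys → IsArrangement (cons-punchIn x ys)
cons-punchIn-isArrangement x {ys} (unique , complete) =
  (All.map⁺ (All.universal (λ y x≡↑y → punchInᵢ≢i x y (sym x≡↑y)) ys) ∷ Unique.map⁺ (punchIn-injective x _ _) unique) ,
  (λ y → member y (x ≟ y))
  where
  member : ∀ y → Dec (x ≡ y) → y ∈ cons-punchIn x ys
  member y (yes refl) = here refl
  member y (no x≢y)   = there (subst (_∈ map (punchIn x) ys) (punchIn-punchOut x≢y)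
                                     (∈-map⁺ (punchIn x) (complete (punchOut x≢y))))

arrangements-isArrangement : ∀ n → All IsArrangement (arrangements n)
arrangements-isArrangement zero    = ([] , λ ()) ∷ []
arrangements-isArrangement (suc n) =
  All.cartesianProductWith⁺ (setoid _) (setoid _) cons-punchIn (allFin (suc n)) (arrangements n)
    (λ {x} _ ys∈ → cons-punchIn-isArrangement x (All.lookup (arrangements-isArrangement n) ys∈))

punchIn-image : ∀ {x : Fin (suc n)} {xs} → All (x ≢_) xs → ∃ λ ys → map (punchIn x) ys ≡ xs
punchIn-image []           = [] , refl
punchIn-image (x≢y ∷ x≢ys) =
  let ys , e = punchIn-image x≢ys in punchOut x≢y ∷ ys , cong₂ _∷_ (punchIn-punchOut x≢y) e

arrangements-complete : {xs : List (Fin n)} → IsArrangement xs → xs ∈ arrangements n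
arrangements-complete {zero}  {[]}     _              = here refl
arrangements-complete {suc n} {[]}     (_ , complete) with () ← complete zero
arrangements-complete {suc n} {x ∷ _}  (x∉ ∷ unique , complete) with ys , refl ← punchIn-image x∉ =
  ∈-cartesianProductWith⁺ cons-punchIn (∈-allFin x) (arrangements-complete (Unique.map⁻ unique , ys-complete))
  where
  ys-complete : ∀ c → c ∈ ys
  ys-complete c with complete (punchIn x c)
  ... | here ↑c≡x    = contradiction ↑c≡x (punchInᵢ≢i x c)
  ... | there ↑c∈↑ys with c' , c'∈ys , ↑c≡↑c' ← ∈-map⁻ (punchIn x) ↑c∈↑ys =
    subst (_∈ ys) (sym (punchIn-injective x c c' ↑c≡↑c')) c'∈ys

words : ℕ → List A → List (List A)
words zero    xs = [ [] ]
words (suc k) xs = cartesianProductWith _∷_ xs (words k xs)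

length-words : ∀ k (xs : List A) → length (words k xs) ≡ length xs ^ k
length-words zero    xs = refl
length-words (suc k) xs =
  trans (length-cartesianProductWith _∷_ xs (words k xs)) (cong (length xs *_) (length-words k xs))

words-unique : ∀ k {xs : List A} → Unique xs → Unique (words k xs)
words-unique zero    _ = [] ∷ []
words-unique (suc k) u = Unique.cartesianProductWith⁺ _∷_ ∷-injective u (words-unique k u)

words-length : ∀ k (xs : List A) → All (λ w → length w ≡ k) (words k xs)
words-length zero    xs = refl ∷ []
words-length (suc k) xs = All.cartesianProductWith⁺ (setoid _) (setoid _) _∷_ xs (words k xs)
  (λ _ w∈ → cong suc (All.lookup (words-length k xs) w∈))

words-complete : {xs w : List A} → All (_∈ xs) w → w ∈ words (length w) xs
words-complete []          = here refl
words-complete (a∈ ∷ w⊆xs) = ∈-cartesianProductWith⁺ _∷_ a∈ (words-complete w⊆xs)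

-- Divisor labels

divisors : ℕ → List ℕ
divisors m = filter (_∣? m) (applyUpTo suc m)

divisorLabels : ℕ → List (ℕ × ℕ)
divisorLabels m = concatMap (λ e → map (e ,_) (upTo e)) (divisors m)

length-divisorLabels : ∀ m → length (divisorLabels m) ≡ σ m
length-divisorLabels m = trans (length-concatMap (λ e → map (e ,_) (upTo e)) (divisors m))
  (cong sum (trans (map-cong (λ e → trans (length-map (e ,_) (upTo e)) (length-upTo e)) (divisors m))
                   (map-id (divisors m))))

∈-divisors : ∀ {m e} .{{_ : NonZero m}} → suc e ∣ m → suc e ∈ divisors m
∈-divisors e∣m = ∈-filter⁺ (_∣? _) (∈-applyUpTo⁺ suc (∣⇒≤ e∣m)) e∣m

∈-divisorLabels : ∀ {m e q} .{{_ : NonZero m}} → e ∣ m → q < e → (e , q) ∈ divisorLabels m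
∈-divisorLabels {e = suc e} e∣m q<e = ∈-concatMap⁺ (λ e → map (e ,_) (upTo e))
  (Any.map (λ { refl → ∈-map⁺ (suc e ,_) (∈-upTo⁺ q<e) }) (∈-divisors e∣m))

/-∈-divisorLabels : ∀ {m d v} .{{_ : NonZero m}} .{{_ : NonZero d}} →
  d ∣ m → v < m → (m / d , v / d) ∈ divisorLabels m
/-∈-divisorLabels {m} {d} d∣m v<m =
  ∈-divisorLabels (m/n∣m d∣m) (m<n*o⇒m/o<n (subst (_ <_) (sym (m/n*n≡m d∣m)) v<m))

m/n≡m/o⇒n≡o : ∀ {m n o} .{{_ : NonZero m}} .{{_ : NonZero n}} .{{_ : NonZero o}} →
  n ∣ m → o ∣ m → m / n ≡ m / o → n ≡ o
m/n≡m/o⇒n≡o {m} {n} {o} n∣m o∣m e = *-cancelʳ-≡ n o (m / n) (begin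
  n * (m / n) ≡⟨ m*[n/m]≡n n∣m ⟩
  m           ≡⟨ m*[n/m]≡n o∣m ⟨
  o * (m / o) ≡⟨ cong (o *_) e ⟨
  o * (m / n) ∎)
  where
  open ≡-Reasoning
  instance
    m/n≢0 : NonZero (m / n)
    m/n≢0 = >-nonZero (m≥n⇒m/n>0 (∣⇒≤ n∣m))

-- Iterates, orbits and periods of a permutation

least-witness : {P : ℕ → Set} → Decidable P → ∀ {n} → P n → ∃ λ a → P a × (∀ {d} → d < a → ¬ P d)
least-witness P? {zero}  P0 = 0 , P0 , λ ()
least-witness P? {suc n} Pn with P? 0
... | yes P0 = 0 , P0 , λ ()
... | no ¬P0 =
  let a , Pa , below = least-witness (P? ∘ suc) Pn
  in suc a , Pa , λ { {zero} _ → ¬P0 ; {suc d} d<a → below (≤-pred d<a) }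

module _ {n} (π : Permutation′ n) where

  open ≡-Reasoning

  iter-+ : ∀ i j x → iter π (i + j) x ≡ iter π i (iter π j x)
  iter-+ zero    j x = refl
  iter-+ (suc i) j x = cong (π ⟨$⟩ʳ_) (iter-+ i j x)

  iter-comm : ∀ i j x → iter π i (iter π j x) ≡ iter π j (iter π i x)
  iter-comm i j x = begin
    iter π i (iter π j x) ≡⟨ iter-+ i j x ⟨
    iter π (i + j) x      ≡⟨ cong (λ t → iter π t x) (+-comm i j) ⟩
    iter π (j + i) x      ≡⟨ iter-+ j i x ⟩
    iter π j (iter π i x) ∎

  iter-injective : ∀ i {x y} → iter π i x ≡ iter π i y → x ≡ y
  iter-injective zero    e = e
  iter-injective (suc i) e =
    iter-injective i (trans (sym (inverseˡ π)) (trans (cong (π ⟨$⟩ˡ_) e) (inverseˡ π)))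

  iter-*-fixed : ∀ {p x} → iter π p x ≡ x → ∀ q → iter π (q * p) x ≡ x
  iter-*-fixed         fx zero    = refl
  iter-*-fixed {p} {x} fx (suc q) = trans (iter-+ p (q * p) x) (trans (cong (iter π p) (iter-*-fixed fx q)) fx)

  iter-%-fixed : ∀ {p x} .{{_ : NonZero p}} → iter π p x ≡ x → ∀ t → iter π (t % p) x ≡ iter π t x
  iter-%-fixed {p} {x} fx t = begin
    iter π (t % p) x                      ≡⟨ cong (iter π (t % p)) (iter-*-fixed fx (t / p)) ⟨
    iter π (t % p) (iter π (t / p * p) x) ≡⟨ iter-+ (t % p) (t / p * p) x ⟨
    iter π (t % p + t / p * p) x          ≡⟨ cong (λ s → iter π s x) (m≡m%n+[m/n]*n t p) ⟨
    iter π t x                            ∎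

  SameCycle-trans : ∀ {x y z} → SameCycle π x y → SameCycle π y z → SameCycle π x z
  SameCycle-trans {x} (i , refl) (j , refl) = j + i , iter-+ j i x

  SameCycle-sym : ∀ {m x y} → PowIsId π (suc m) → SameCycle π x y → SameCycle π y x
  SameCycle-sym {m} {x} π^[1+m]≡id (k , refl) = m * k , (begin
    iter π (m * k) (iter π k x) ≡⟨ iter-+ (m * k) k x ⟨
    iter π (m * k + k) x        ≡⟨ cong (λ t → iter π t x) (trans (+-comm (m * k) k) (*-comm (suc m) k)) ⟩
    iter π (k * suc m) x        ≡⟨ iter-*-fixed (π^[1+m]≡id x) k ⟩
    x                           ∎)

  orbit : Fin n → ℕ → List (Fin n)
  orbit x p = applyUpTo (λ t → iter π t x) p

  length-orbit : ∀ x p → length (orbit x p) ≡ p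
  length-orbit x p = length-applyUpTo (λ t → iter π t x) p

  ∈orbit⇒SameCycle : ∀ {x p y} → y ∈ orbit x p → SameCycle π x y
  ∈orbit⇒SameCycle {x} y∈ with t , _ , refl ← ∈-applyUpTo⁻ (λ t → iter π t x) y∈ = t , refl

  SameCycle⇒∈orbit : ∀ {x p y} .{{_ : NonZero p}} → iter π p x ≡ x → SameCycle π x y → y ∈ orbit x p
  SameCycle⇒∈orbit {x} {p} fx (t , refl) =
    subst (_∈ orbit x p) (iter-%-fixed fx t) (∈-applyUpTo⁺ (λ t → iter π t x) (m%n<n t p))

  IsPeriod : Fin n → ℕ → Set
  IsPeriod x p = iter π p x ≡ x × (∀ {i j} → i < j → j < p → iter π i x ≢ iter π j x)

  IsPeriod-injective : ∀ {x p i j} → IsPeriod x p → i < p → j < p → iter π i x ≡ iter π j x → i ≡ j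
  IsPeriod-injective {i = i} {j} (_ , distinct) i<p j<p e with <-cmp i j
  ... | tri< i<j _ _ = contradiction e (distinct i<j j<p)
  ... | tri≈ _ i≡j _ = i≡j
  ... | tri> _ _ j<i = contradiction (sym e) (distinct j<i i<p)

  IsPeriod-iter : ∀ {x p} s → IsPeriod x p → IsPeriod (iter π s x) p
  IsPeriod-iter {x} {p} s (fx , distinct) =
    trans (iter-comm p s x) (cong (iter π s) fx) ,
    λ {i} {j} i<j j<p e → distinct i<j j<p (iter-injective s (trans (iter-comm s i x) (trans e (iter-comm j s x))))

  orbit-unique : ∀ {x p} → IsPeriod x p → Unique (orbit x p)
  orbit-unique (_ , distinct) = Unique.applyUpTo⁺₁ _ _ distinct

  period∣ : ∀ {x a m} → IsPeriod x (suc a) → iter π m x ≡ x → suc a ∣ m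
  period∣ {x} {a} {m} per fx = m%n≡0⇒n∣m m (suc a)
    (IsPeriod-injective per (m%n<n m (suc a)) (s≤s z≤n) (trans (iter-%-fixed (proj₁ per) m) fx))

  period : ∀ {m} → PowIsId π (suc m) → ∀ x → ∃ λ a → IsPeriod x (suc a)
  period {m} π^[1+m]≡id x =
    let a , returns , minimal = least-witness (λ d → iter π (suc d) x ≟ x) {m} (π^[1+m]≡id x)
    in a , returns , distinct minimal
    where
    distinct : ∀ {a} → (∀ {d} → d < a → iter π (suc d) x ≢ x) →
               ∀ {i j} → i < j → j < suc a → iter π i x ≢ iter π j x
    distinct minimal {i} i<j j<1+a e with d , refl ← m≤n⇒∃[o]m+o≡n i<j =
      minimal (≤-trans (s≤s (m≤n+m d i)) (≤-pred j<1+a)) (iter-injective i (begin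
        iter π i (iter π (suc d) x) ≡⟨ iter-+ i (suc d) x ⟨
        iter π (i + suc d) x        ≡⟨ cong (λ t → iter π t x) (+-suc i d) ⟩
        iter π (suc i + d) x        ≡⟨ e ⟨
        iter π i x                  ∎))

IsCycleList : ∀ {n} → Permutation′ n → List (Fin n) → Set
IsCycleList π b = ∃₂ λ x a → iter π (suc a) x ≡ x × b ≡ orbit π x (suc a)

applyUpTo-pointwise : (f g : ℕ → A) (p : ℕ) → applyUpTo f p ≡ applyUpTo g p → ∀ {t} → t < p → f t ≡ g t
applyUpTo-pointwise f g (suc p) e {zero}  _         = ∷-injectiveˡ e
applyUpTo-pointwise f g (suc p) e {suc t} (s≤s t<p) =
  applyUpTo-pointwise (f ∘ suc) (g ∘ suc) p (∷-injectiveʳ e) t<p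

cycleLists-agree : ∀ {n} {π π' : Permutation′ n} {b y} → IsCycleList π b → IsCycleList π' b →
  y ∈ b → π ⟨$⟩ʳ y ≡ π' ⟨$⟩ʳ y
cycleLists-agree {π = π} {π'} (x , a , fx , refl) (x' , a' , fx' , e) y∈
  with refl ← suc-injective
                (trans (sym (length-orbit π x (suc a))) (trans (cong length e) (length-orbit π' x' (suc a'))))
  with t , t<1+a , refl ← ∈-applyUpTo⁻ (λ t → iter π t x) y∈
  = agree-at t<1+a
  where
  open ≡-Reasoning
  same : ∀ {t} → t < suc a → iter π t x ≡ iter π' t x'
  same = applyUpTo-pointwise (λ t → iter π t x) (λ t → iter π' t x') (suc a) e
  agree-at : ∀ {t} → t < suc a → iter π (suc t) x ≡ π' ⟨$⟩ʳ iter π t x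
  agree-at t<1+a with m≤n⇒m<n∨m≡n (≤-pred t<1+a)
  ... | inj₁ t<a  = trans (same (s≤s t<a)) (cong (π' ⟨$⟩ʳ_) (sym (same t<1+a)))
  ... | inj₂ refl = begin
    iter π (suc a) x        ≡⟨ fx ⟩
    x                       ≡⟨ same (s≤s z≤n) ⟩
    x'                      ≡⟨ fx' ⟨
    iter π' (suc a) x'      ≡⟨ cong (π' ⟨$⟩ʳ_) (same t<1+a) ⟨
    π' ⟨$⟩ʳ iter π a x      ∎

-- Encoding a permutation together with the extra data

OrderDivides⇒PowIsId : ∀ {n} (π : Permutation′ n) {m} → OrderDivides π m → PowIsId π m
OrderDivides⇒PowIsId π (_ , (_ , π^k≡id , _) , divides q refl) x = iter-*-fixed π (π^k≡id x) q

Tuple : ℕ → ℕ → ℕ → Set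
Tuple n k M = Fin n × List (Fin k) × List (Fin M)

Admissible : ∀ {n k M} → Tuple n k M → Set
Admissible {k = k} (_ , o , u) = IsArrangement o × length u ≡ k

Code : ℕ → Set
Code n = List (Fin n) × List (ℕ × ℕ)

codes : ∀ n k M → List (Code n)
codes n k M = cartesianProduct (arrangements n) (words k (divisorLabels M))

module Linearisation {n k m} (π : Permutation′ n) (π^M≡id : PowIsId π (suc m))
                     (cycles : HasCycleCount π (suc k)) where

  private
    r : Fin (suc k) → Fin n
    r = proj₁ cycles

  cycleIndex : Fin n → Fin (suc k)
  cycleIndex x = proj₁ (proj₁ (proj₂ cycles) x)

  r-cycleIndex : ∀ x → SameCycle π (r (cycleIndex x)) x
  r-cycleIndex x = proj₂ (proj₁ (proj₂ cycles) x)

  r-injective : ∀ {i j} → SameCycle π (r i) (r j) → i ≡ j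
  r-injective = proj₂ (proj₂ cycles) _ _

  cycleLength : Fin n → ℕ
  cycleLength x = suc (proj₁ (period π {m} π^M≡id x))

  cycleLength-isPeriod : ∀ x → IsPeriod π x (cycleLength x)
  cycleLength-isPeriod x = proj₂ (period π {m} π^M≡id x)

  cycleLength∣M : ∀ x → cycleLength x ∣ suc m
  cycleLength∣M x = period∣ π (cycleLength-isPeriod x) (π^M≡id x)

  otherRep : Fin n → Fin k → Fin n
  otherRep x j = r (punchIn (cycleIndex x) j)

  shift : Fin n → Fin k × Fin (suc m) → ℕ
  shift x (j , v) = toℕ v % cycleLength (otherRep x j)

  start : Fin n → Fin k × Fin (suc m) → Fin n
  start x (j , v) = iter π (shift x (j , v)) (otherRep x j)

  block : Fin n → Fin k × Fin (suc m) → List (Fin n)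
  block x (j , v) = orbit π (start x (j , v)) (cycleLength (otherRep x j))

  label : Fin n → Fin k × Fin (suc m) → ℕ × ℕ
  label x (j , v) = suc m / cycleLength (otherRep x j) , toℕ v / cycleLength (otherRep x j)

  ownCycle : Fin n → List (Fin n)
  ownCycle x = orbit π x (cycleLength x)

  word : Tuple n k (suc m) → List (Fin n)
  word (x , o , u) = concatMap (block x) (zip o u) ++ ownCycle x

  labels : Tuple n k (suc m) → List (ℕ × ℕ)
  labels (x , o , u) = map (label x) (zip o u)

  code : Tuple n k (suc m) → Code n
  code t = word t , labels t

  private
    SameCycle-sym′ : ∀ {x y} → SameCycle π x y → SameCycle π y x
    SameCycle-sym′ = SameCycle-sym π {m} π^M≡id

  otherRep~start : ∀ x j v → SameCycle π (otherRep x j) (start x (j , v))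
  otherRep~start x j v = shift x (j , v) , refl

  start-isPeriod : ∀ x j v → IsPeriod π (start x (j , v)) (cycleLength (otherRep x j))
  start-isPeriod x j v = IsPeriod-iter π (shift x (j , v)) (cycleLength-isPeriod (otherRep x j))

  block-isCycleList : ∀ x p → IsCycleList π (block x p)
  block-isCycleList x (j , v) = start x (j , v) , _ , proj₁ (start-isPeriod x j v) , refl

  ownCycle-isCycleList : ∀ x → IsCycleList π (ownCycle x)
  ownCycle-isCycleList x = x , _ , proj₁ (cycleLength-isPeriod x) , refl

  ∈blocks⇒IsCycleList : ∀ {x ps b} → b ∈ map (block x) ps → IsCycleList π b
  ∈blocks⇒IsCycleList {x} b∈ with p , _ , refl ← ∈-map⁻ (block x) b∈ = block-isCycleList x p

  ∈block⇒SameCycle : ∀ {x y} j v → y ∈ block x (j , v) → SameCycle π (otherRep x j) y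
  ∈block⇒SameCycle {x} j v y∈ = SameCycle-trans π (otherRep~start x j v) (∈orbit⇒SameCycle π y∈)

  SameCycle⇒∈block : ∀ {x j y} v → SameCycle π (otherRep x j) y → y ∈ block x (j , v)
  SameCycle⇒∈block {x} {j} v c~y = SameCycle⇒∈orbit π (proj₁ (start-isPeriod x j v))
    (SameCycle-trans π (SameCycle-sym′ (otherRep~start x j v)) c~y)

  otherRep-injective : ∀ {x j j'} → SameCycle π (otherRep x j) (otherRep x j') → j ≡ j'
  otherRep-injective {x} c~c' = punchIn-injective (cycleIndex x) _ _ (r-injective c~c')

  SameCycle⇒∈ownCycle : ∀ {x y} → SameCycle π x y → y ∈ ownCycle x
  SameCycle⇒∈ownCycle {x} = SameCycle⇒∈orbit π (proj₁ (cycleLength-isPeriod x))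

  otherRep-≁ : ∀ {x j} → ¬ SameCycle π (otherRep x j) x
  otherRep-≁ {x} {j} c~x =
    punchInᵢ≢i (cycleIndex x) j (r-injective (SameCycle-trans π c~x (SameCycle-sym′ (r-cycleIndex x))))

  blocks-disjoint : ∀ {x p p'} → proj₁ p ≢ proj₁ p' → Disjoint (block x p) (block x p')
  blocks-disjoint {p = j , v} {j' , v'} j≢j' (y∈ , y∈') =
    j≢j' (otherRep-injective
      (SameCycle-trans π (∈block⇒SameCycle j v y∈) (SameCycle-sym′ (∈block⇒SameCycle j' v' y∈'))))

  blocks-ownCycle-disjoint : ∀ {x ps} → Disjoint (concatMap (block x) ps) (ownCycle x)
  blocks-ownCycle-disjoint {x} {ps} (y∈blocks , y∈own)
    with (j , v) , y∈b ← Any.satisfied (∈-concatMap⁻ (block x) {ps} y∈blocks) =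
    otherRep-≁ (SameCycle-trans π (∈block⇒SameCycle j v y∈b) (SameCycle-sym′ (∈orbit⇒SameCycle π y∈own)))

  word-unique : ∀ x {o u} → Unique o → length o ≡ length u → Unique (word (x , o , u))
  word-unique x {o} {u} o-unique o≡u = Unique.++⁺
    (Unique.concat⁺ (All.map⁺ (All.universal block-unique (zip o u)))
                    (AllPairs.map⁺ (AllPairs.map (λ {p} {p'} → blocks-disjoint {x} {p} {p'}) pieces-distinct)))
    (orbit-unique π (cycleLength-isPeriod x))
    (blocks-ownCycle-disjoint {x} {zip o u})
    where
    block-unique : ∀ p → Unique (block x p)
    block-unique (j , v) = orbit-unique π (start-isPeriod x j v)
    pieces-distinct : AllPairs (λ p p' → proj₁ p ≢ proj₁ p') (zip o u)
    pieces-distinct = AllPairs.map⁻ (subst Unique (sym (map-proj₁-zip o u o≡u)) o-unique)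

  word-complete : ∀ x {o u} → (∀ j → j ∈ o) → length o ≡ length u → ∀ y → y ∈ word (x , o , u)
  word-complete x {o} {u} o-complete o≡u y with cycleIndex y | r-cycleIndex y
  ... | i | rᵢ~y with cycleIndex x ≟ i
  ...   | yes refl =
    ∈-++⁺ʳ _ (SameCycle⇒∈ownCycle (SameCycle-trans π (SameCycle-sym′ (r-cycleIndex x)) rᵢ~y))
  ...   | no i₀≢i
    with (j , v) , p∈ , refl ←
           ∈-map⁻ proj₁ (subst (_ ∈_) (sym (map-proj₁-zip o u o≡u)) (o-complete (punchOut i₀≢i))) =
    ∈-++⁺ˡ (∈-concat⁺′
      (SameCycle⇒∈block v (subst (λ i → SameCycle π (r i) y) (sym (punchIn-punchOut i₀≢i)) rᵢ~y))
      (∈-map⁺ (block x) p∈))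

  word-isArrangement : ∀ {t} → Admissible t → IsArrangement (word t)
  word-isArrangement {x , o , u} ((o-unique , o-complete) , u≡k) =
    word-unique x o-unique o≡u , word-complete x o-complete o≡u
    where
    o≡u : length o ≡ length u
    o≡u = trans (arrangement-length (o-unique , o-complete)) (sym u≡k)

  labels-length : ∀ {t} → Admissible t → length (labels t) ≡ k
  labels-length {x , o , u} (arrangement , u≡k) = begin
    length (map (label x) (zip o u))  ≡⟨ length-map (label x) (zip o u) ⟩
    length (zip o u)                  ≡⟨ length-map proj₁ (zip o u) ⟨
    length (map proj₁ (zip o u))      ≡⟨ cong length (map-proj₁-zip o u (trans o≡k (sym u≡k))) ⟩
    length o                          ≡⟨ o≡k ⟩
    k                                 ∎
    where
    open ≡-Reasoning
    o≡k : length o ≡ k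
    o≡k = arrangement-length arrangement

  label-∈ : ∀ x p → label x p ∈ divisorLabels (suc m)
  label-∈ x (j , v) = /-∈-divisorLabels (cycleLength∣M (otherRep x j)) (toℕ<n v)

  code-∈ : ∀ {t} → Admissible t → code t ∈ codes n k (suc m)
  code-∈ {t@(x , o , u)} adm = ∈-cartesianProduct⁺ (arrangements-complete (word-isArrangement adm))
    (subst (λ l → labels t ∈ words l (divisorLabels (suc m))) (labels-length adm)
      (words-complete (All.map⁺ (All.universal (label-∈ x) (zip o u)))))

  start-injectiveˡ : ∀ {x j v j' v'} → start x (j , v) ≡ start x (j' , v') → j ≡ j'
  start-injectiveˡ {x} {j} {v} {j'} {v'} e = otherRep-injective (SameCycle-trans π
    (subst (SameCycle π (otherRep x j)) e (otherRep~start x j v)) (SameCycle-sym′ (otherRep~start x j' v')))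

  -- The block fixes the cycle and v mod its length; the label fixes the quotient.
  block-label-injective : ∀ {x p p'} → block x p ≡ block x p' → label x p ≡ label x p' → p ≡ p'
  block-label-injective {x} {j , v} {j' , v'} b≡b' l≡l'
    with refl ← start-injectiveˡ {x} {j} {v} {j'} {v'} (∷-injectiveˡ b≡b') = cong (j ,_) (toℕ-injective (begin
      toℕ v                      ≡⟨ m≡m%n+[m/n]*n (toℕ v) L ⟩
      toℕ v % L + toℕ v / L * L   ≡⟨ cong₂ (λ s q → s + q * L) shifts≡ (cong proj₂ l≡l') ⟩
      toℕ v' % L + toℕ v' / L * L ≡⟨ m≡m%n+[m/n]*n (toℕ v') L ⟨
      toℕ v'                     ∎))
    where
    open ≡-Reasoning
    L : ℕ
    L = cycleLength (otherRep x j)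
    shifts≡ : toℕ v % L ≡ toℕ v' % L
    shifts≡ = IsPeriod-injective π (cycleLength-isPeriod (otherRep x j)) (m%n<n (toℕ v) L) (m%n<n (toℕ v') L)
                                 (∷-injectiveˡ b≡b')

module _ {n k m} {π π' : Permutation′ n} (π^M≡id : PowIsId π (suc m)) (π'^M≡id : PowIsId π' (suc m))
         (cycles : HasCycleCount π (suc k)) (cycles' : HasCycleCount π' (suc k)) where

  private
    module L  = Linearisation {m = m} π  π^M≡id  cycles
    module L' = Linearisation {m = m} π' π'^M≡id cycles'

  code-split : ∀ {x o u x' o' u'} → L.code (x , o , u) ≡ L'.code (x' , o' , u') →
    map (L.block x) (zip o u) ≡ map (L'.block x') (zip o' u') × L.ownCycle x ≡ L'.ownCycle x'
  code-split {x} {o} {u} {x'} {o'} {u'} e =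
    concat-++-injective (map (L.block x) (zip o u)) (map (L'.block x') (zip o' u')) block-lengths (cong proj₁ e)
    where
    same-length : ∀ {p p'} → L.label x p ≡ L'.label x' p' → length (L.block x p) ≡ length (L'.block x' p')
    same-length {j , v} {j' , v'} l≡l' = begin
      length (L.block x (j , v))
        ≡⟨ length-orbit π (L.start x (j , v)) (L.cycleLength (L.otherRep x j)) ⟩
      L.cycleLength (L.otherRep x j)
        ≡⟨ m/n≡m/o⇒n≡o (L.cycleLength∣M (L.otherRep x j)) (L'.cycleLength∣M (L'.otherRep x' j'))
                       (cong proj₁ l≡l') ⟩
      L'.cycleLength (L'.otherRep x' j')
        ≡⟨ length-orbit π' (L'.start x' (j' , v')) (L'.cycleLength (L'.otherRep x' j')) ⟨
      length (L'.block x' (j' , v')) ∎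
      where open ≡-Reasoning
    block-lengths : map length (map (L.block x) (zip o u)) ≡ map length (map (L'.block x') (zip o' u'))
    block-lengths = trans (sym (map-∘ (zip o u)))
      (trans (map-≡⇒map-≡ (λ {p} {p'} → same-length {p} {p'}) (cong proj₂ e)) (map-∘ (zip o' u')))

  code-determines-permutation : ∀ {t t'} → Admissible t → L.code t ≡ L'.code t' → π ≈ π'
  code-determines-permutation {x , o , u} {x' , o' , u'} adm e y
    with blocks≡ , own≡ ← code-split e
    with ∈-++⁻ (concatMap (L.block x) (zip o u)) (proj₂ (L.word-isArrangement adm) y)
  ... | inj₁ y∈blocks =
    let b , y∈b , b∈ = ∈-concat⁻′ (map (L.block x) (zip o u)) y∈blocks
    in cycleLists-agree (L.∈blocks⇒IsCycleList b∈) (L'.∈blocks⇒IsCycleList (subst (b ∈_) blocks≡ b∈))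
                        y∈b
  ... | inj₂ y∈own =
    cycleLists-agree (L.ownCycle-isCycleList x) (subst (IsCycleList π') (sym own≡) (L'.ownCycle-isCycleList x'))
                     y∈own

code-injective : ∀ {n k m} {π : Permutation′ n}
  (π^M≡id : PowIsId π (suc m)) (cycles : HasCycleCount π (suc k)) →
  let open Linearisation {m = m} π π^M≡id cycles in
  ∀ {t t'} → Admissible t → Admissible t' → code t ≡ code t' → t ≡ t'
code-injective {m = m} {π} π^M≡id cycles {x , o , u} {x' , o' , u'} (arr , u≡k) (arr' , u'≡k) e
  with blocks≡ , own≡ ← code-split {m = m} π^M≡id π^M≡id cycles cycles e
  with refl ← ∷-injectiveˡ own≡
  = cong (x ,_) (cong₂ _,_
      (trans (sym (map-proj₁-zip o u o≡u)) (trans (cong (map proj₁) pieces≡) (map-proj₁-zip o' u' o'≡u')))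
      (trans (sym (map-proj₂-zip o u o≡u)) (trans (cong (map proj₂) pieces≡) (map-proj₂-zip o' u' o'≡u'))))
  where
  open Linearisation {m = m} π π^M≡id cycles
  o≡u : length o ≡ length u
  o≡u = trans (arrangement-length arr) (sym u≡k)
  o'≡u' : length o' ≡ length u'
  o'≡u' = trans (arrangement-length arr') (sym u'≡k)
  pieces≡ : zip o u ≡ zip o' u'
  pieces≡ = map-injective₂ (λ {p} {p'} → block-label-injective {x} {p} {p'}) blocks≡ (cong proj₂ e)

-- Counting

tuples : ∀ n k M → List (Tuple n k M)
tuples n k M = cartesianProduct (allFin n) (cartesianProduct (arrangements k) (words k (allFin M)))

length-tuples : ∀ n k M → length (tuples n k M) ≡ n * (k ! * M ^ k)
length-tuples n k M = begin
  length (tuples n k M)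
    ≡⟨ length-cartesianProductWith _,_ (allFin n) _ ⟩
  length (allFin n) * length (cartesianProduct (arrangements k) (words k (allFin M)))
    ≡⟨ cong₂ _*_ (length-allFin n) (length-cartesianProductWith _,_ (arrangements k) _) ⟩
  n * (length (arrangements k) * length (words k (allFin M)))
    ≡⟨ cong (n *_) (cong₂ _*_ (length-arrangements k)
                              (trans (length-words k (allFin M)) (cong (_^ k) (length-allFin M)))) ⟩
  n * (k ! * M ^ k) ∎
  where open ≡-Reasoning

tuples-unique : ∀ n k M → Unique (tuples n k M)
tuples-unique n k M = Unique.cartesianProduct⁺ (Unique.allFin⁺ n)
  (Unique.cartesianProduct⁺ (arrangements-unique k) (words-unique k (Unique.allFin⁺ M)))

tuples-admissible : ∀ n k M → All Admissible (tuples n k M)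
tuples-admissible n k M = All.cartesianProduct⁺ (setoid _) (setoid _) (allFin n) _ λ _ ou∈ →
  let o∈ , u∈ = ∈-cartesianProduct⁻ (arrangements k) (words k (allFin M)) ou∈
  in All.lookup (arrangements-isArrangement k) o∈ , All.lookup (words-length k (allFin M)) u∈

length-codes : ∀ n k M → length (codes n k M) ≡ n ! * σ M ^ k
length-codes n k M = begin
  length (codes n k M)
    ≡⟨ length-cartesianProductWith _,_ (arrangements n) (words k (divisorLabels M)) ⟩
  length (arrangements n) * length (words k (divisorLabels M))
    ≡⟨ cong₂ _*_ (length-arrangements n)
                 (trans (length-words k (divisorLabels M)) (cong (_^ k) (length-divisorLabels M))) ⟩
  n ! * σ M ^ k ∎
  where open ≡-Reasoning

module _ {n k m : ℕ} where

  encode : Σ (Permutation′ n) (Event (suc k) (suc m)) → Tuple n k (suc m) → Code n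
  encode (π , cycles , order∣) = Linearisation.code {m = m} π (OrderDivides⇒PowIsId π order∣) cycles

  encode-∈ : ∀ e {t} → Admissible t → encode e t ∈ codes n k (suc m)
  encode-∈ (π , cycles , order∣) = Linearisation.code-∈ {m = m} π (OrderDivides⇒PowIsId π order∣) cycles

  encode-injective : ∀ e {t t'} → Admissible t → Admissible t' → encode e t ≡ encode e t' → t ≡ t'
  encode-injective (π , cycles , order∣) = code-injective {m = m} (OrderDivides⇒PowIsId π order∣) cycles

  encodings-disjoint : ∀ {e e'} → Distinct (proj₁ e) (proj₁ e') →
    Disjoint (map (encode e) (tuples n k (suc m))) (map (encode e') (tuples n k (suc m)))
  encodings-disjoint {π , cycles , order∣} {π' , cycles' , order∣'} π≉π' (c∈ , c∈')
    with t , t∈ , refl ← ∈-map⁻ (encode (π , cycles , order∣)) c∈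
    with t' , _ , c≡ ← ∈-map⁻ (encode (π' , cycles' , order∣')) c∈' =
    π≉π' (code-determines-permutation (OrderDivides⇒PowIsId π order∣) (OrderDivides⇒PowIsId π' order∣')
            cycles cycles' (All.lookup (tuples-admissible n k (suc m)) t∈) c≡)

  distinct-events-bound : (es : List (Σ (Permutation′ n) (Event (suc k) (suc m)))) →
    AllPairs (λ e e' → Distinct (proj₁ e) (proj₁ e')) es →
    length es * (n * (k ! * suc m ^ k)) ≤ n ! * σ (suc m) ^ k
  distinct-events-bound es distinct = begin
    length es * (n * (k ! * suc m ^ k))       ≡⟨ cong (length es *_) (length-tuples n k (suc m)) ⟨
    length es * length T                      ≡⟨ length-cartesianProductWith encode es T ⟨
    length (cartesianProductWith encode es T) ≤⟨ Unique⇒length≤ encodings-unique encodings-∈ ⟩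
    length (codes n k (suc m))                ≡⟨ length-codes n k (suc m) ⟩
    n ! * σ (suc m) ^ k                       ∎
    where
    open ≤-Reasoning
    T : List (Tuple n k (suc m))
    T = tuples n k (suc m)
    encodings-unique : Unique (cartesianProductWith encode es T)
    encodings-unique = Unique-cartesianProductWith⁺ encode
      (λ e → Unique-map⁺-injectiveOn (encode-injective e) (tuples-admissible n k (suc m))
                                                         (tuples-unique n k (suc m)))
      (λ {e} {e'} → encodings-disjoint {e} {e'}) distinct
    encodings-∈ : All (_∈ codes n k (suc m)) (cartesianProductWith encode es T)
    encodings-∈ = All.cartesianProductWith⁺ (setoid _) (setoid _) encode es T
      (λ {e} _ t∈ → encode-∈ e (All.lookup (tuples-admissible n k (suc m)) t∈))

corollary2p4 : (ℓ m n : ℕ) → 1 ≤ ℓ → 1 ≤ m → 1 ≤ n →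
    (ps : List (Permutation′ n)) → AllPairs Distinct ps → All (Event ℓ m) ps →
    length ps * (n * ((ℓ ∸ 1) ! * m ^ (ℓ ∸ 1))) ≤ n ! * σ m ^ (ℓ ∸ 1)
corollary2p4 (suc k) (suc m) n _ _ _ ps distinct events =
  subst (λ l → l * (n * (k ! * suc m ^ k)) ≤ n ! * σ (suc m) ^ k) length-es
    (distinct-events-bound (All.toList events) (AllPairs.map⁻ (subst (AllPairs Distinct) (sym proj₁-es) distinct)))
  where
  proj₁-es : map proj₁ (All.toList events) ≡ ps
  proj₁-es = map-proj₁-toList events
  length-es : length (All.toList events) ≡ length ps
  length-es = trans (sym (length-map proj₁ (All.toList events))) (cong length proj₁-es)
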